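{- Let $p\in\mathbb{Z}_{\ge1}$ and let $S\subseteq\mathbb{Z}_{\ge2}$ be non-empty and $p$-symmetric. In $\mathcal{L}\mathcal{R}$-Subtraction Nim with removable set $S$, the outcome sequence $(\mathcal{O}_S(n))_{n\ge0}$ does not have period $1$, i.e. there is no $A\in\mathbb{Z}_{\ge0}$ such that $\mathcal{O}_S(n)$ is constant for $n\ge A$. In particular, it is not the case that $\mathcal{O}_S(n)=\mathcal{L}$ for all sufficiently large $n$.
   Context: A non-empty set $S\subseteq\mathbb{Z}_{\ge1}$ is $p$-symmetric if $p-s\in S$ for all $s\in S$. $\mathcal{L}\mathcal{R}$-Subtraction Nim with removable set $S\subseteq\mathbb{Z}_{\ge2}$: a position is a number $n\in\mathbb{Z}_{\ge0}$ of tokens. Players Left and Right alternate moves; a move from $n$ removes $s\in S$ tokens with $s\le n$. When the player to move has no move (i.e. $n<\min S$), the game ends; Left wins if $n$ is even and Right wins if $n$ is odd. The outcome $\mathcal{O}_S(n)$ is $\mathcal{L}$ (resp. $\mathcal{R}$) if Left (resp. Right) has a winning strategy from $n$ both moving first and moving second, $\mathcal{N}$ if the first player (whichever) has a winning strategy, and $\mathcal{P}$ if the second player (whichever) has one. -}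

module Defs where

open import Data.Nat using (ℕ; _≤_; _<_; _∸_)
open import Data.Nat.DivMod using (_%_)
open import Relation.Binary.PropositionalEquality using (_≡_)
open import Data.Product using (_×_; ∃)

Even Odd : ℕ → Set
Even n = n % 2 ≡ 0
Odd n = n % 2 ≡ 1

Subset : Set₁
Subset = ℕ → Set

-- p-symmetric: p - s ∈ S for all s ∈ S.  (Since S ⊆ ℤ≥2 is assumed separately,
-- truncated subtraction p ∸ s never causes a spurious member: if s ≥ p then
-- p ∸ s = 0 ∉ S.)
PSymmetric : ℕ → Subset → Set
PSymmetric p S = ∀ s → S s → S (p ∸ s)

NoMove : Subset → ℕ → Set
NoMove S n = ∀ s → S s → n < s

-- LFirst S n  : Left wins from n when Left moves first (Left to move)
--   LSecond S n : Left wins from n when Right moves first (Right to move)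
--   RFirst S n  : Right wins from n when Right is to move
--   RSecond S n : Right wins from n when Left is to move
-- Terminal positions: Left wins iff n is even, Right wins iff n is odd.
mutual
  data LFirst (S : Subset) (n : ℕ) : Set where
    l-end  : NoMove S n → Even n → LFirst S n
    l-move : (s : ℕ) → S s → s ≤ n → LSecond S (n ∸ s) → LFirst S n

  data LSecond (S : Subset) (n : ℕ) : Set where
    l-end : NoMove S n → Even n → LSecond S n
    l-all : (∃ λ s → S s × s ≤ n) →
            (∀ s → S s → s ≤ n → LFirst S (n ∸ s)) → LSecond S n

mutual
  data RFirst (S : Subset) (n : ℕ) : Set where
    r-end  : NoMove S n → Odd n → RFirst S n
    r-move : (s : ℕ) → S s → s ≤ n → RSecond S (n ∸ s) → RFirst S n

  data RSecond (S : Subset) (n : ℕ) : Set where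
    r-end : NoMove S n → Odd n → RSecond S n
    r-all : (∃ λ s → S s × s ≤ n) →
            (∀ s → S s → s ≤ n → RFirst S (n ∸ s)) → RSecond S n

data Outcome : Set where
  𝓛 𝓡 𝓝 𝓟 : Outcome

HasOutcome : Subset → ℕ → Outcome → Set
HasOutcome S n 𝓛 = LFirst S n × LSecond S n
HasOutcome S n 𝓡 = RFirst S n × RSecond S n
HasOutcome S n 𝓝 = LFirst S n × RFirst S n
HasOutcome S n 𝓟 = LSecond S n × RSecond S n

-- Against a p-symmetric set S, the second player can mirror: whenever
-- the opponent removes s, answer with p − s.  Each round removes exactly p
-- tokens, so whoever wins from n moving second also wins from p + n.  Since
-- Left wins from 0 and Right from 1, Left wins moving second from every
-- multiple of p and Right from every position 1 + kp, which rules out the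
-- eventually constant outcomes 𝓛, 𝓡 and 𝓝.  An eventually constant 𝓟 fails
-- because a Left-second win at n gives a Left-first win at n + s for s ∈ S.
module Submission where

open import Defs
open import Data.Nat using (ℕ; zero; suc; _+_; _*_; _∸_; _≤_; _≤?_; z≤n; s≤s)
open import Data.Nat.Properties
open import Data.Product using (_×_; ∃; ∃₂; _,_)
open import Relation.Nullary using (¬_; yes; no; contradiction)
open import Relation.Binary.PropositionalEquality

mutual
  LSecond⇒¬RFirst : ∀ {S n} → LSecond S n → ¬ RFirst S n
  LSecond⇒¬RFirst (l-end _ even) (r-end _ odd) with () ← trans (sym even) odd
  LSecond⇒¬RFirst (l-end noMove _) (r-move s Ss s≤n _) = <⇒≱ (noMove s Ss) s≤n
  LSecond⇒¬RFirst (l-all (s , Ss , s≤n) _) (r-end noMove _) = <⇒≱ (noMove s Ss) s≤n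
  LSecond⇒¬RFirst (l-all _ reply) (r-move s Ss s≤n r) = LFirst⇒¬RSecond (reply s Ss s≤n) r

  LFirst⇒¬RSecond : ∀ {S n} → LFirst S n → ¬ RSecond S n
  LFirst⇒¬RSecond (l-end _ even) (r-end _ odd) with () ← trans (sym even) odd
  LFirst⇒¬RSecond (l-end noMove _) (r-all (s , Ss , s≤n) _) = <⇒≱ (noMove s Ss) s≤n
  LFirst⇒¬RSecond (l-move s Ss s≤n _) (r-end noMove _) = <⇒≱ (noMove s Ss) s≤n
  LFirst⇒¬RSecond (l-move s Ss s≤n l) (r-all _ reply) = LSecond⇒¬RFirst l (reply s Ss s≤n)

LSecond⇒LFirst-+ : ∀ {S n s} → S s → LSecond S n → LFirst S (n + s)
LSecond⇒LFirst-+ {S} {n} {s} Ss L =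
  l-move s Ss (m≤n+m s n) (subst (LSecond S) (sym (m+n∸n≡m n s)) L)

module PSymmetricMirror (p : ℕ) (S : Subset) (s₀ : ℕ) (Ss₀ : S s₀)
                        (S≥2 : ∀ s → S s → 2 ≤ s) (symmetric : PSymmetric p S) where

  0∉S : ¬ S 0
  0∉S S0 = contradiction (S≥2 0 S0) λ ()

  ∈S⇒≤p : ∀ {t} → S t → t ≤ p
  ∈S⇒≤p {t} St with t ≤? p
  ... | yes t≤p = t≤p
  ... | no t≰p =
    contradiction (subst S (m≤n⇒m∸n≡0 (<⇒≤ (≰⇒> t≰p))) (symmetric t St)) 0∉S

  mirror-≤ : ∀ n t → p ∸ t ≤ p + n ∸ t
  mirror-≤ n t = ∸-monoˡ-≤ t (m≤m+n p n)

  mirror-lands : ∀ n {t} → t ≤ p → p + n ∸ t ∸ (p ∸ t) ≡ n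
  mirror-lands n {t} t≤p = begin
    p + n ∸ t ∸ (p ∸ t)     ≡⟨ cong (_∸ (p ∸ t)) (+-∸-comm n t≤p) ⟩
    (p ∸ t) + n ∸ (p ∸ t)   ≡⟨ m+n∸m≡n (p ∸ t) n ⟩
    n                       ∎
    where open ≡-Reasoning

  s₀≤p+ : ∀ n → s₀ ≤ p + n
  s₀≤p+ n = ≤-trans (∈S⇒≤p Ss₀) (m≤m+n p n)

  LSecond-p+ : ∀ {n} → LSecond S n → LSecond S (p + n)
  LSecond-p+ {n} L = l-all (s₀ , Ss₀ , s₀≤p+ n) λ t St _ →
    let t≤p = ∈S⇒≤p St in
    l-move (p ∸ t) (symmetric t St) (mirror-≤ n t)
      (subst (LSecond S) (sym (mirror-lands n t≤p)) L)

  RSecond-p+ : ∀ {n} → RSecond S n → RSecond S (p + n)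
  RSecond-p+ {n} R = r-all (s₀ , Ss₀ , s₀≤p+ n) λ t St _ →
    let t≤p = ∈S⇒≤p St in
    r-move (p ∸ t) (symmetric t St) (mirror-≤ n t)
      (subst (RSecond S) (sym (mirror-lands n t≤p)) R)

  LSecond-*p : ∀ k → LSecond S (k * p)
  LSecond-*p zero    = l-end (λ s Ss → ≤-trans (s≤s z≤n) (S≥2 s Ss)) refl
  LSecond-*p (suc k) = LSecond-p+ (LSecond-*p k)

  RSecond-1+*p : ∀ k → RSecond S (1 + k * p)
  RSecond-1+*p zero    = r-end S≥2 refl
  RSecond-1+*p (suc k) = subst (RSecond S) (+-suc p (k * p)) (RSecond-p+ (RSecond-1+*p k))

proposition10 : (p : ℕ) → 1 ≤ p → (S : ℕ → Set) →
    (∃ λ s → S s) → (∀ s → S s → 2 ≤ s) → PSymmetric p S →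
    (¬ (∃₂ λ A o → ∀ n → A ≤ n → HasOutcome S n o))
    × (¬ (∃ λ A → ∀ n → A ≤ n → HasOutcome S n 𝓛))
proposition10 p@(suc _) _ S (s₀ , Ss₀) S≥2 symmetric =
  notEventuallyConstant , λ (A , eventually𝓛) →
    notEventuallyConstant (A , 𝓛 , eventually𝓛)
  where
  open PSymmetricMirror p S s₀ Ss₀ S≥2 symmetric

  notEventuallyConstant : ¬ (∃₂ λ A o → ∀ n → A ≤ n → HasOutcome S n o)
  notEventuallyConstant (A , 𝓛 , H)
    with (lFirst , _) ← H (1 + A * p) (m≤n⇒m≤1+n (m≤m*n A p))
    = LFirst⇒¬RSecond lFirst (RSecond-1+*p A)
  notEventuallyConstant (A , 𝓡 , H) with (rFirst , _) ← H (A * p) (m≤m*n A p)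
    = LSecond⇒¬RFirst (LSecond-*p A) rFirst
  notEventuallyConstant (A , 𝓝 , H) with (_ , rFirst) ← H (A * p) (m≤m*n A p)
    = LSecond⇒¬RFirst (LSecond-*p A) rFirst
  notEventuallyConstant (A , 𝓟 , H) with (lSecond , _) ← H A ≤-refl
                                      | (_ , rSecond) ← H (A + s₀) (m≤m+n A s₀)
    = LFirst⇒¬RSecond (LSecond⇒LFirst-+ Ss₀ lSecond) rSecond
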